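{- Let $\Gamma$ be a strongly regular graph with parameters $(n,k,\lambda,\mu)$ which is locally $3$-isoregular at a vertex $x$. Let $y$ be a neighbour of $x$ such that $(x,y)$ is $3$-isoregular, with associated parameters $Q,R,W$, and let $z\ne x$ be a non-neighbour of $x$ such that $(x,z)$ is $3$-isoregular, with associated parameters $R',W',V$. Then $R=R'$ and $W=W'$.
   Context: All graphs are finite, simple and connected. A strongly regular graph with parameters $(n,k,\lambda,\mu)$ is a $k$-regular graph on $n$ vertices in which adjacent vertices have exactly $\lambda$ common neighbours and distinct non-adjacent vertices have exactly $\mu$ common neighbours; it is assumed non-trivial (it and its complement are connected). For a vertex set $T$, the valency of $T$ is the number of vertices adjacent to every vertex of $T$. An ordered pair $(x,y)$ of distinct vertices is $3$-isoregular if for all vertices $z\ne x,y$ the valency of $\{x,y,z\}$ depends only on the isomorphism type of the subgraph induced on $\{x,y,z\}$. $\Gamma$ is locally $3$-isoregular at $x$ if there exist a neighbour $y$ and a non-neighbour $z\ne x$ of $x$ with $(x,y)$ and $(x,z)$ both $3$-isoregular. For a $3$-isoregular edge $(x,y)$ the associated parameters $Q,R,W$ are the valencies of $\{x,y,v\}$ when the induced subgraph is $K_3$, $K_{1,2}$, $K_2+K_1$ respectively; for a $3$-isoregular non-edge $(x,z)$ the associated parameters $R',W',V$ are the valencies of $\{x,z,v\}$ when the induced subgraph is $K_{1,2}$, $K_2+K_1$, $3K_1$ respectively. -}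

module Defs where

open import Data.Nat using (ℕ; zero; suc; _+_)
open import Data.Bool using (Bool; true; false; _∧_; not; if_then_else_)
open import Data.Fin using (Fin; _≟_)
open import Data.List using (List; map; allFin)
open import Data.Nat.ListAction using (sum)
open import Data.Product using (_×_)
open import Relation.Nullary using (¬_)
open import Relation.Nullary.Decidable using (⌊_⌋)
open import Relation.Binary.PropositionalEquality using (_≡_; _≢_)

record Graph (n : ℕ) : Set where
  field
    adj    : Fin n → Fin n → Bool
    sym    : ∀ u v → adj u v ≡ adj v u
    irrefl : ∀ v → adj v v ≡ false
open Graph public

Adj : ∀ {n} → Graph n → Fin n → Fin n → Set
Adj G u v = adj G u v ≡ true

complement : ∀ {n} → Graph n → Graph n
complement {n} G = record
  { adj = λ u v → not (adj G u v) ∧ not ⌊ u ≟ v ⌋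
  ; sym = symc
  ; irrefl = irc }
  where
  open import Relation.Binary.PropositionalEquality using (refl; cong₂; cong)
  open import Relation.Nullary using (yes; no)
  symc : ∀ u v → (not (adj G u v) ∧ not ⌊ u ≟ v ⌋) ≡ (not (adj G v u) ∧ not ⌊ v ≟ u ⌋)
  symc u v with u ≟ v | v ≟ u
  ... | yes _ | yes _ = cong₂ _∧_ (cong not (Graph.sym G u v)) refl
  ... | no _  | no _  = cong₂ _∧_ (cong not (Graph.sym G u v)) refl
  ... | yes refl | no p with p refl
  ... | ()
  symc u v | no p | yes refl with p refl
  ... | ()
  irc : ∀ v → (not (adj G v v) ∧ not ⌊ v ≟ v ⌋) ≡ false
  irc v with v ≟ v
  ... | yes _ = Data.Bool.Properties.∧-zeroʳ (not (adj G v v))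
    where import Data.Bool.Properties
  ... | no p with p refl
  ... | ()

data Reach {n : ℕ} (G : Graph n) : Fin n → Fin n → Set where
  here : ∀ {u} → Reach G u u
  step : ∀ {u v w} → Adj G u v → Reach G v w → Reach G u w

Connected : ∀ {n} → Graph n → Set
Connected G = ∀ u v → Reach G u v

count : ∀ {n} → (Fin n → Bool) → ℕ
count {n} p = sum (map (λ i → if p i then 1 else 0) (allFin n))

degree : ∀ {n} → Graph n → Fin n → ℕ
degree G v = count (λ w → adj G v w)

val2 : ∀ {n} → Graph n → Fin n → Fin n → ℕ
val2 G u v = count (λ w → adj G u w ∧ adj G v w)

val3 : ∀ {n} → Graph n → Fin n → Fin n → Fin n → ℕ
val3 G u v t = count (λ w → adj G u w ∧ adj G v w ∧ adj G t w)

-- non-trivial strongly regular graph with parameters (n,k,λ,μ)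
record IsSRG {n : ℕ} (G : Graph n) (k l m : ℕ) : Set where
  field
    connected    : Connected G
    coConnected  : Connected (complement G)
    regular      : ∀ v → degree G v ≡ k
    adjCommon    : ∀ u v → Adj G u v → val2 G u v ≡ l
    nonadjCommon : ∀ u v → u ≢ v → ¬ Adj G u v → val2 G u v ≡ m

data TriType : Set where
  K3 K12 K2+K1 3K1 : TriType

b2n : Bool → ℕ
b2n true = 1
b2n false = 0

-- isomorphism type of the induced subgraph on {u,v,t} (three distinct
-- vertices); a graph on 3 vertices is determined up to isomorphism by its
-- number of edges.
triType : ∀ {n} → Graph n → Fin n → Fin n → Fin n → TriType
triType G u v t with b2n (adj G u v) + b2n (adj G u t) + b2n (adj G v t)
... | 0 = 3K1
... | 1 = K2+K1
... | 2 = K12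
... | _ = K3

Isoregular3 : ∀ {n} → Graph n → Fin n → Fin n → Set
Isoregular3 G x y =
  x ≢ y ×
  (∀ z z' → z ≢ x → z ≢ y → z' ≢ x → z' ≢ y →
    triType G x y z ≡ triType G x y z' → val3 G x y z ≡ val3 G x y z')

ParamFor : ∀ {n} → Graph n → Fin n → Fin n → TriType → ℕ → Set
ParamFor G x y T P =
  ∀ v → v ≢ x → v ≢ y → triType G x y v ≡ T → val3 G x y v ≡ P

Locally3Isoregular : ∀ {n} → Graph n → Fin n → Set
Locally3Isoregular {n} G x =
  Data.Product.Σ (Fin n) λ y → Data.Product.Σ (Fin n) λ z →
    Adj G x y × ¬ Adj G x z × z ≢ x × Isoregular3 G x y × Isoregular3 G x z
  where import Data.Product

-- Write Γ and Δ for the neighbours of x and the non-neighbours of x other than x, A and B for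
-- the numbers of neighbours and non-neighbours of y in Δ, and C for the number of vertices of Γ
-- not adjacent to z.  Counting the edges between Γ and Δ gives k A = (A + B) m, and k = m + C,
-- so C A = B m.  Summing the valency of {x,y,v} over v ∈ Δ and that of {x,z,v} over v ∈ Γ, and
-- exchanging the order of summation, gives A R + B W = l A and m R' + C W' = m l; eliminating l
-- with C A = B m yields m A R + B m W = m A R' + B m W'.  The triple {x,y,z} shows R = R' when
-- y ~ z and W = W' otherwise, and the other equality follows by cancelling m A or B m, which are
-- nonzero because Γ and its complement are connected.
module Submission where

open import Data.Bool using (Bool; true; false; _∧_; not; if_then_else_)
open import Data.Bool.Properties
  using (∧-identityʳ; ∧-zeroʳ; ∧-assoc; ∧-comm; ∧-conicalˡ; ∧-conicalʳ; not-injective; not-¬; ¬-not)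
open import Data.Fin using (Fin; zero; suc; punchIn; _≟_)
open import Data.Fin.Properties using (punchInᵢ≢i)
open import Data.List using (map; tabulate; _∷_; [])
open import Data.List.Properties using (map-tabulate)
open import Data.Nat using (ℕ; zero; suc; _+_; _*_; NonZero)
import Data.Nat.ListAction as List
open import Data.Nat.Properties
  using (*-comm; *-distribʳ-+; suc-injective; +-identityʳ; +-cancelˡ-≡; +-cancelʳ-≡; *-cancelˡ-≡;
         +-*-semiring; m*n≢0; m*n≢0⇒m≢0; m*n≢0⇒n≢0)
open import Algebra.Properties.Semiring.Sum +-*-semiring
  using (sum; sum-syntax; sum-cong-≗; sum-remove; sum-replicate-zero; ∑-comm; ∑-distrib-+;
         *-distribˡ-sum; *-distribʳ-sum)
open import Data.Nat.Tactic.RingSolver using (solve)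
open import Data.Product using (_×_; _,_; ∃₂)
open import Data.Sum using (_⊎_; inj₁; inj₂)
open import Function using (_∘_; id)
open import Relation.Nullary using (¬_; yes; no; contradiction)
open import Relation.Nullary.Decidable using (⌊_⌋)
open import Relation.Binary.PropositionalEquality

open import Defs hiding (sym)

private
  variable
    n : ℕ

b2n-if : ∀ b → (if b then 1 else 0) ≡ b2n b
b2n-if true  = refl
b2n-if false = refl

b2n-split : ∀ a b → b2n a ≡ b2n (a ∧ b) + b2n (a ∧ not b)
b2n-split true  true  = refl
b2n-split true  false = refl
b2n-split false _     = refl

listSum-tabulate : (f : Fin n → ℕ) → List.sum (tabulate f) ≡ ∑[ i < n ] f i
listSum-tabulate {zero}  f = refl
listSum-tabulate {suc n} f = cong (f zero +_) (listSum-tabulate (f ∘ suc))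

count-as-∑ : (p : Fin n → Bool) → count p ≡ ∑[ i < n ] b2n (p i)
count-as-∑ {n} p = begin
  List.sum (map indicator (tabulate id)) ≡⟨ cong List.sum (map-tabulate id indicator) ⟩
  List.sum (tabulate indicator)          ≡⟨ listSum-tabulate indicator ⟩
  ∑[ i < n ] indicator i                 ≡⟨ sum-cong-≗ (b2n-if ∘ p) ⟩
  ∑[ i < n ] b2n (p i)                   ∎
  where
  open ≡-Reasoning
  indicator : Fin n → ℕ
  indicator i = if p i then 1 else 0

count-cong : {p q : Fin n → Bool} → (∀ i → p i ≡ q i) → count p ≡ count q
count-cong {p = p} {q} p≗q =
  trans (count-as-∑ p) (trans (sum-cong-≗ (cong b2n ∘ p≗q)) (sym (count-as-∑ q)))

count-split : (p q : Fin n → Bool) →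
  count p ≡ count (λ i → p i ∧ q i) + count (λ i → p i ∧ not (q i))
count-split {n} p q = begin
  count p
    ≡⟨ count-as-∑ p ⟩
  ∑[ i < n ] b2n (p i)
    ≡⟨ sum-cong-≗ (λ i → b2n-split (p i) (q i)) ⟩
  ∑[ i < n ] (b2n (p∧q i) + b2n (p∧¬q i))
    ≡⟨ ∑-distrib-+ (b2n ∘ p∧q) (b2n ∘ p∧¬q) ⟩
  ∑[ i < n ] b2n (p∧q i) + ∑[ i < n ] b2n (p∧¬q i)
    ≡⟨ sym (cong₂ _+_ (count-as-∑ p∧q) (count-as-∑ p∧¬q)) ⟩
  count p∧q + count p∧¬q ∎
  where
  open ≡-Reasoning
  p∧q p∧¬q : Fin n → Bool
  p∧q i = p i ∧ q i
  p∧¬q i = p i ∧ not (q i)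

count-nonZero : {p : Fin n → Bool} (i : Fin n) → p i ≡ true → NonZero (count p)
count-nonZero {suc _} {p} i pi rewrite count-as-∑ p | sum-remove {i = i} (b2n ∘ p) | pi = _

count-∧-≟ : (p : Fin n → Bool) (i : Fin n) → count (λ j → p j ∧ ⌊ i ≟ j ⌋) ≡ b2n (p i)
count-∧-≟ {suc n} p i = begin
  count (λ j → p j ∧ ⌊ i ≟ j ⌋)
    ≡⟨ count-as-∑ (λ j → p j ∧ ⌊ i ≟ j ⌋) ⟩
  sum t
    ≡⟨ sum-remove {i = i} t ⟩
  t i + ∑[ j < n ] t (punchIn i j)
    ≡⟨ cong₂ _+_ t-at-i (trans (sum-cong-≗ t-off-i) (sum-replicate-zero n)) ⟩
  b2n (p i) + 0
    ≡⟨ +-identityʳ _ ⟩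
  b2n (p i) ∎
  where
  open ≡-Reasoning
  t : Fin (suc n) → ℕ
  t j = b2n (p j ∧ ⌊ i ≟ j ⌋)
  t-at-i : t i ≡ b2n (p i)
  t-at-i with i ≟ i
  ... | yes _   = cong b2n (∧-identityʳ (p i))
  ... | no  i≢i = contradiction refl i≢i
  t-off-i : ∀ j → t (punchIn i j) ≡ 0
  t-off-i j with i ≟ punchIn i j
  ... | yes i≡ = contradiction (sym i≡) (punchInᵢ≢i i j)
  ... | no  _  = cong b2n (∧-zeroʳ (p (punchIn i j)))

sumOver : (Fin n → Bool) → (Fin n → ℕ) → ℕ
sumOver {n} p f = ∑[ i < n ] (b2n (p i) * f i)

sumOver-cong : (p : Fin n → Bool) {f g : Fin n → ℕ} → (∀ i → f i ≡ g i) → sumOver p f ≡ sumOver p g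
sumOver-cong p f≗g = sum-cong-≗ (λ i → cong (b2n (p i) *_) (f≗g i))

sumOver-const : (p : Fin n → Bool) (f : Fin n → ℕ) {c : ℕ} →
  (∀ i → p i ≡ true → f i ≡ c) → sumOver p f ≡ count p * c
sumOver-const {n} p f {c} f≡c = begin
  sumOver p f                 ≡⟨ sum-cong-≗ on-p ⟩
  ∑[ i < n ] (b2n (p i) * c)  ≡⟨ *-distribʳ-sum c (b2n ∘ p) ⟨
  ∑[ i < n ] b2n (p i) * c    ≡⟨ cong (_* c) (count-as-∑ p) ⟨
  count p * c                 ∎
  where
  open ≡-Reasoning
  on-p : ∀ i → b2n (p i) * f i ≡ b2n (p i) * c
  on-p i with p i in pi
  ... | true  = cong (1 *_) (f≡c i pi)
  ... | false = refl

sumOver-split : (p q : Fin n → Bool) (f : Fin n → ℕ) →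
  sumOver p f ≡ sumOver (λ i → p i ∧ q i) f + sumOver (λ i → p i ∧ not (q i)) f
sumOver-split p q f =
  trans (sum-cong-≗ (λ i → split (p i) (q i) (f i)))
        (∑-distrib-+ (λ i → b2n (p i ∧ q i) * f i) (λ i → b2n (p i ∧ not (q i)) * f i))
  where
  split : ∀ a b x → b2n a * x ≡ b2n (a ∧ b) * x + b2n (a ∧ not b) * x
  split true  true  x = sym (+-identityʳ (1 * x))
  split true  false x = refl
  split false _     x = refl

sumOver-two-valued : (p q : Fin n → Bool) (f : Fin n → ℕ) {a b : ℕ} →
  (∀ i → p i ∧ q i ≡ true → f i ≡ a) → (∀ i → p i ∧ not (q i) ≡ true → f i ≡ b) →
  sumOver p f ≡ count (λ i → p i ∧ q i) * a + count (λ i → p i ∧ not (q i)) * b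
sumOver-two-valued p q f on-q on-¬q = trans (sumOver-split p q f)
  (cong₂ _+_ (sumOver-const _ f on-q) (sumOver-const _ f on-¬q))

degreeIn : Graph n → (Fin n → Bool) → Fin n → ℕ
degreeIn G p v = count (λ w → p w ∧ adj G v w)

nonDegreeIn : Graph n → (Fin n → Bool) → Fin n → ℕ
nonDegreeIn G p v = count (λ w → p w ∧ not (adj G v w))

count≡degreeIn+nonDegreeIn : (G : Graph n) (p : Fin n → Bool) (v : Fin n) →
  count p ≡ degreeIn G p v + nonDegreeIn G p v
count≡degreeIn+nonDegreeIn G p v = count-split p (adj G v)

sumOver-count : (p : Fin n → Bool) (r : Fin n → Fin n → Bool) →
  sumOver p (λ v → count (r v)) ≡ ∑[ v < n ] ∑[ w < n ] (b2n (p v) * b2n (r v w))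
sumOver-count p r = sum-cong-≗ λ v →
  trans (cong (b2n (p v) *_) (count-as-∑ (r v))) (*-distribˡ-sum (b2n (p v)) (b2n ∘ r v))

sumOver-degreeIn-comm : (G : Graph n) (p q : Fin n → Bool) →
  sumOver p (degreeIn G q) ≡ sumOver q (degreeIn G p)
sumOver-degreeIn-comm {n} G p q = begin
  sumOver p (degreeIn G q)
    ≡⟨ sumOver-count p (λ v w → q w ∧ adj G v w) ⟩
  ∑[ v < n ] ∑[ w < n ] (b2n (p v) * b2n (q w ∧ adj G v w))
    ≡⟨ ∑-comm (λ v w → b2n (p v) * b2n (q w ∧ adj G v w)) ⟩
  ∑[ w < n ] ∑[ v < n ] (b2n (p v) * b2n (q w ∧ adj G v w))
    ≡⟨ sum-cong-≗ (λ w → sum-cong-≗ (λ v → edge v w)) ⟩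
  ∑[ w < n ] ∑[ v < n ] (b2n (q w) * b2n (p v ∧ adj G w v))
    ≡⟨ sumOver-count q (λ w v → p v ∧ adj G w v) ⟨
  sumOver q (degreeIn G p) ∎
  where
  open ≡-Reasoning
  swap : ∀ a b c → b2n a * b2n (b ∧ c) ≡ b2n b * b2n (a ∧ c)
  swap true  true  _ = refl
  swap true  false _ = refl
  swap false true  _ = refl
  swap false false _ = refl
  edge : ∀ v w → b2n (p v) * b2n (q w ∧ adj G v w) ≡ b2n (q w) * b2n (p v ∧ adj G w v)
  edge v w rewrite Graph.sym G v w = swap (p v) (q w) (adj G w v)

sumOver-val3 : (G : Graph n) (p : Fin n → Bool) (u v : Fin n) →
  sumOver p (val3 G u v) ≡ sumOver (λ w → adj G u w ∧ adj G v w) (degreeIn G p)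
sumOver-val3 G p u v = trans
  (sumOver-cong p (λ t → count-cong (λ w → sym (∧-assoc (adj G u w) (adj G v w) (adj G t w)))))
  (sumOver-degreeIn-comm G p (λ w → adj G u w ∧ adj G v w))

crossing-edge : (H : Graph n) (p : Fin n → Bool) {s t : Fin n} → Reach H s t →
  p s ≡ false → p t ≡ true → ∃₂ λ u v → Adj H u v × p u ≡ false × p v ≡ true
crossing-edge H p here ps pt = contradiction (trans (sym ps) pt) λ ()
crossing-edge H p (step {v = v} sv walk) ps pt with p v in pv
... | true  = _ , v , sv , ps , pv
... | false = crossing-edge H p walk pv pt

adj⇒≢ : (G : Graph n) {u v : Fin n} → Adj G u v → u ≢ v
adj⇒≢ G {u} uv refl = not-¬ (irrefl G u) uv

triType-edge : (G : Graph n) {u v t : Fin n} {b : Bool} →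
  adj G u v ≡ true → adj G u t ≡ false → adj G v t ≡ b →
  triType G u v t ≡ (if b then K12 else K2+K1)
triType-edge G {b = true}  uv ut vt rewrite uv | ut | vt = refl
triType-edge G {b = false} uv ut vt rewrite uv | ut | vt = refl

triType-nonedge : (G : Graph n) {u v t : Fin n} {b : Bool} →
  adj G u v ≡ false → adj G u t ≡ true → adj G v t ≡ b →
  triType G u v t ≡ (if b then K12 else K2+K1)
triType-nonedge G {b = true}  uv ut vt rewrite uv | ut | vt = refl
triType-nonedge G {b = false} uv ut vt rewrite uv | ut | vt = refl

val3-swap : (G : Graph n) (u v t : Fin n) → val3 G u v t ≡ val3 G u t v
val3-swap G u v t = count-cong (λ w → cong (adj G u w ∧_) (∧-comm (adj G v w) (adj G t w)))

cancel-weighted-pair : ∀ a b {r r′ w w′ : ℕ} → NonZero a → NonZero b →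
  a * r + b * w ≡ a * r′ + b * w′ → r ≡ r′ ⊎ w ≡ w′ → r ≡ r′ × w ≡ w′
cancel-weighted-pair a b {r} a≢0 b≢0 eq (inj₁ refl) =
  refl , *-cancelˡ-≡ _ _ b {{b≢0}} (+-cancelˡ-≡ (a * r) _ _ eq)
cancel-weighted-pair a b {w = w} a≢0 b≢0 eq (inj₂ refl) =
  *-cancelˡ-≡ _ _ a {{a≢0}} (+-cancelʳ-≡ (b * w) _ _ eq) , refl

eliminate-l : ∀ {l m A B C R W R′ W′ : ℕ} → C * A ≡ B * m →
  A * R + B * W ≡ l * A → m * R′ + C * W′ ≡ m * l →
  m * A * R + B * m * W ≡ m * A * R′ + B * m * W′
eliminate-l {l} {m} {A} {B} {C} {R} {W} {R′} {W′} CA≡Bm eqA eqm = begin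
  m * A * R + B * m * W    ≡⟨ solve (m ∷ A ∷ R ∷ B ∷ W ∷ []) ⟩
  m * (A * R + B * W)      ≡⟨ cong (m *_) eqA ⟩
  m * (l * A)              ≡⟨ solve (m ∷ l ∷ A ∷ []) ⟩
  A * (m * l)              ≡⟨ cong (A *_) eqm ⟨
  A * (m * R′ + C * W′)    ≡⟨ solve (A ∷ m ∷ R′ ∷ C ∷ W′ ∷ []) ⟩
  m * A * R′ + C * A * W′  ≡⟨ cong (λ c → m * A * R′ + c * W′) CA≡Bm ⟩
  m * A * R′ + B * m * W′  ∎
  where open ≡-Reasoning

module Subconstituents {G : Graph n} {k l m : ℕ} (srg : IsSRG G k l m) (x : Fin n) where
  open IsSRG srg

  Γ Δ : Fin n → Bool
  Γ = adj G x
  Δ = adj (complement G) x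

  Δ-intro : ∀ {v} → adj G x v ≡ false → x ≢ v → Δ v ≡ true
  Δ-intro {v} xv x≢v rewrite xv with x ≟ v
  ... | yes x≡v = contradiction x≡v x≢v
  ... | no  _   = refl

  Δ⇒nonadj : ∀ {v} → Δ v ≡ true → adj G x v ≡ false
  Δ⇒nonadj Δv = not-injective (∧-conicalˡ _ _ Δv)

  Δ⇒≢ : ∀ {v} → Δ v ≡ true → x ≢ v
  Δ⇒≢ Δv refl = not-¬ (irrefl (complement G) x) Δv

  Γ-Δ-≢ : ∀ {u v} → Γ u ≡ true → Δ v ≡ true → u ≢ v
  Γ-Δ-≢ Γu Δv refl = not-¬ (Δ⇒nonadj Δv) Γu

  val2-Δ : ∀ {v} → Δ v ≡ true → val2 G x v ≡ m
  val2-Δ Δv = nonadjCommon x _ (Δ⇒≢ Δv) (not-¬ (Δ⇒nonadj Δv))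

  Γ-degreeIn-Δ : ∀ {w} → Γ w ≡ true → k ≡ l + suc (degreeIn G Δ w)
  Γ-degreeIn-Δ {w} xw = begin
    k
      ≡⟨ regular w ⟨
    count (adj G w)
      ≡⟨ count-split (adj G w) Γ ⟩
    count (λ v → adj G w v ∧ Γ v) + count outside-Γ
      ≡⟨ cong₂ _+_ in-Γ (count-split outside-Γ (λ v → ⌊ x ≟ v ⌋)) ⟩
    l + (count (λ v → outside-Γ v ∧ ⌊ x ≟ v ⌋) + count (λ v → outside-Γ v ∧ not ⌊ x ≟ v ⌋))
      ≡⟨ cong₂ (λ a b → l + (a + b)) at-x (count-cong in-Δ) ⟩
    l + suc (degreeIn G Δ w) ∎
    where
    open ≡-Reasoning
    outside-Γ : Fin n → Bool
    outside-Γ v = adj G w v ∧ not (Γ v)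
    in-Γ : count (λ v → adj G w v ∧ Γ v) ≡ l
    in-Γ = trans (count-cong (λ v → ∧-comm (adj G w v) (Γ v))) (adjCommon x w xw)
    at-x : count (λ v → outside-Γ v ∧ ⌊ x ≟ v ⌋) ≡ 1
    at-x rewrite count-∧-≟ outside-Γ x | Graph.sym G w x | xw | irrefl G x = refl
    in-Δ : ∀ v → outside-Γ v ∧ not ⌊ x ≟ v ⌋ ≡ Δ v ∧ adj G w v
    in-Δ v = trans (∧-assoc (adj G w v) _ _) (∧-comm (adj G w v) _)

  degreeIn-Δ-const : ∀ {w w′} → Γ w ≡ true → Γ w′ ≡ true → degreeIn G Δ w ≡ degreeIn G Δ w′
  degreeIn-Δ-const Γw Γw′ =
    suc-injective (+-cancelˡ-≡ l _ _ (trans (sym (Γ-degreeIn-Δ Γw)) (Γ-degreeIn-Δ Γw′)))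

  Δ-nonDegreeIn-Γ : ∀ {u} → Δ u ≡ true → k ≡ m + nonDegreeIn G Γ u
  Δ-nonDegreeIn-Γ {u} Δu =
    trans (sym (regular x))
          (trans (count≡degreeIn+nonDegreeIn G Γ u) (cong (_+ nonDegreeIn G Γ u) (val2-Δ Δu)))

  edges-Γ-Δ : ∀ {y} → Γ y ≡ true → k * degreeIn G Δ y ≡ count Δ * m
  edges-Γ-Δ {y} xy = begin
    k * degreeIn G Δ y
      ≡⟨ cong (_* degreeIn G Δ y) (regular x) ⟨
    count Γ * degreeIn G Δ y
      ≡⟨ sumOver-const Γ (degreeIn G Δ) (λ w Γw → degreeIn-Δ-const Γw xy) ⟨
    sumOver Γ (degreeIn G Δ)
      ≡⟨ sumOver-degreeIn-comm G Γ Δ ⟩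
    sumOver Δ (degreeIn G Γ)
      ≡⟨ sumOver-const Δ (degreeIn G Γ) (λ v → val2-Δ) ⟩
    count Δ * m ∎
    where open ≡-Reasoning

  balance-Γ-Δ : ∀ {y z} → Γ y ≡ true → Δ z ≡ true →
    nonDegreeIn G Γ z * degreeIn G Δ y ≡ nonDegreeIn G Δ y * m
  balance-Γ-Δ {y} {z} xy Δz = +-cancelˡ-≡ (A * m) _ _ (begin
    A * m + C * A    ≡⟨ cong (_+ C * A) (*-comm A m) ⟩
    m * A + C * A    ≡⟨ *-distribʳ-+ A m C ⟨
    (m + C) * A      ≡⟨ cong (_* A) (Δ-nonDegreeIn-Γ Δz) ⟨
    k * A            ≡⟨ edges-Γ-Δ xy ⟩
    count Δ * m      ≡⟨ cong (_* m) (count≡degreeIn+nonDegreeIn G Δ y) ⟩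
    (A + B) * m      ≡⟨ *-distribʳ-+ m A B ⟩
    A * m + B * m    ∎)
    where
    open ≡-Reasoning
    A B C : ℕ
    A = degreeIn G Δ y
    B = nonDegreeIn G Δ y
    C = nonDegreeIn G Γ z

  ∉Δ⇒Γ : ∀ {v} → Δ v ≡ false → x ≢ v → Γ v ≡ true
  ∉Δ⇒Γ Δv x≢v = ¬-not λ xv → not-¬ Δv (Δ-intro xv x≢v)

  m-nonZero : ∀ {z} → Δ z ≡ true → NonZero m
  m-nonZero {z} Δz with crossing-edge G Δ (connected x z) (irrefl (complement G) x) Δz
  ... | u , v , uv , Δu , Δv =
    subst NonZero (val2-Δ Δv) (count-nonZero u (cong₂ _∧_ (∉Δ⇒Γ Δu x≢u) (trans (Graph.sym G v u) uv)))
    where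
    x≢u : x ≢ u
    x≢u refl = not-¬ (Δ⇒nonadj Δv) uv

  nonDegreeIn-Γ-nonZero : ∀ {y z} → Γ y ≡ true → Δ z ≡ true → NonZero (nonDegreeIn G Γ z)
  nonDegreeIn-Γ-nonZero {y} {z} xy Δz
    with crossing-edge (complement G) Γ (coConnected x y) (irrefl G x) xy
  ... | u , v , uv , Γu , Γv =
    subst NonZero (+-cancelˡ-≡ m _ _ (trans (sym (Δ-nonDegreeIn-Γ Δu)) (Δ-nonDegreeIn-Γ Δz)))
      (count-nonZero v (cong₂ _∧_ Γv (∧-conicalˡ _ _ uv)))
    where
    Δu : Δ u ≡ true
    Δu = Δ-intro Γu λ { refl → not-¬ (Δ⇒nonadj uv) Γv }

  degreeIn-Δ-nonZero : ∀ {y z} → Γ y ≡ true → Δ z ≡ true → NonZero (degreeIn G Δ y)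
  degreeIn-Δ-nonZero {z = z} xy Δz = m*n≢0⇒n≢0 k {{subst NonZero (sym (edges-Γ-Δ xy)) |Δ|m≢0}}
    where
    |Δ|m≢0 : NonZero (count Δ * m)
    |Δ|m≢0 = m*n≢0 (count Δ) m {{count-nonZero z Δz}} {{m-nonZero Δz}}

  nonDegreeIn-Δ-nonZero : ∀ {y z} → Γ y ≡ true → Δ z ≡ true → NonZero (nonDegreeIn G Δ y)
  nonDegreeIn-Δ-nonZero xy Δz = m*n≢0⇒m≢0 _ {{subst NonZero (balance-Γ-Δ xy Δz) CA≢0}}
    where
    CA≢0 : NonZero (nonDegreeIn G Γ _ * degreeIn G Δ _)
    CA≢0 = m*n≢0 _ _ {{nonDegreeIn-Γ-nonZero xy Δz}} {{degreeIn-Δ-nonZero xy Δz}}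

  edge-param-at-Δ : ∀ {y v b P} → Γ y ≡ true → Δ v ≡ true → adj G y v ≡ b →
    ParamFor G x y (if b then K12 else K2+K1) P → val3 G x y v ≡ P
  edge-param-at-Δ xy Δv yv P-param =
    P-param _ (≢-sym (Δ⇒≢ Δv)) (≢-sym (Γ-Δ-≢ xy Δv)) (triType-edge G xy (Δ⇒nonadj Δv) yv)

  nonedge-param-at-Γ : ∀ {z v b P} → Δ z ≡ true → Γ v ≡ true → adj G z v ≡ b →
    ParamFor G x z (if b then K12 else K2+K1) P → val3 G x z v ≡ P
  nonedge-param-at-Γ Δz Γv zv P-param =
    P-param _ (≢-sym (adj⇒≢ G Γv)) (Γ-Δ-≢ Γv Δz) (triType-nonedge G (Δ⇒nonadj Δz) Γv zv)

  edge-equation : ∀ {y R W} → Γ y ≡ true → ParamFor G x y K12 R → ParamFor G x y K2+K1 W →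
    degreeIn G Δ y * R + nonDegreeIn G Δ y * W ≡ l * degreeIn G Δ y
  edge-equation {y} {R} {W} xy R-param W-param = begin
    degreeIn G Δ y * R + nonDegreeIn G Δ y * W
      ≡⟨ sumOver-two-valued Δ (adj G y) (val3 G x y) on-K12 on-K2+K1 ⟨
    sumOver Δ (val3 G x y)
      ≡⟨ sumOver-val3 G Δ x y ⟩
    sumOver (λ w → Γ w ∧ adj G y w) (degreeIn G Δ)
      ≡⟨ sumOver-const _ (degreeIn G Δ) on-Γ∧Γ[y] ⟩
    val2 G x y * degreeIn G Δ y
      ≡⟨ cong (_* degreeIn G Δ y) (adjCommon x y xy) ⟩
    l * degreeIn G Δ y ∎
    where
    open ≡-Reasoning
    on-K12 : ∀ v → Δ v ∧ adj G y v ≡ true → val3 G x y v ≡ R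
    on-K12 v h = edge-param-at-Δ xy (∧-conicalˡ _ _ h) (∧-conicalʳ _ _ h) R-param
    on-K2+K1 : ∀ v → Δ v ∧ not (adj G y v) ≡ true → val3 G x y v ≡ W
    on-K2+K1 v h = edge-param-at-Δ xy (∧-conicalˡ _ _ h) (not-injective (∧-conicalʳ _ _ h)) W-param
    on-Γ∧Γ[y] : ∀ w → Γ w ∧ adj G y w ≡ true → degreeIn G Δ w ≡ degreeIn G Δ y
    on-Γ∧Γ[y] w h = degreeIn-Δ-const (∧-conicalˡ _ _ h) xy

  nonedge-equation : ∀ {z R′ W′} → Δ z ≡ true → ParamFor G x z K12 R′ → ParamFor G x z K2+K1 W′ →
    m * R′ + nonDegreeIn G Γ z * W′ ≡ m * l
  nonedge-equation {z} {R′} {W′} Δz R′-param W′-param = begin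
    m * R′ + nonDegreeIn G Γ z * W′
      ≡⟨ cong (λ c → c * R′ + nonDegreeIn G Γ z * W′) (val2-Δ Δz) ⟨
    degreeIn G Γ z * R′ + nonDegreeIn G Γ z * W′
      ≡⟨ sumOver-two-valued Γ (adj G z) (val3 G x z) on-K12 on-K2+K1 ⟨
    sumOver Γ (val3 G x z)
      ≡⟨ sumOver-val3 G Γ x z ⟩
    sumOver (λ w → Γ w ∧ adj G z w) (degreeIn G Γ)
      ≡⟨ sumOver-const _ (degreeIn G Γ) on-Γ∧Γ[z] ⟩
    val2 G x z * l
      ≡⟨ cong (_* l) (val2-Δ Δz) ⟩
    m * l ∎
    where
    open ≡-Reasoning
    on-K12 : ∀ v → Γ v ∧ adj G z v ≡ true → val3 G x z v ≡ R′
    on-K12 v h = nonedge-param-at-Γ Δz (∧-conicalˡ _ _ h) (∧-conicalʳ _ _ h) R′-param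
    on-K2+K1 : ∀ v → Γ v ∧ not (adj G z v) ≡ true → val3 G x z v ≡ W′
    on-K2+K1 v h = nonedge-param-at-Γ Δz (∧-conicalˡ _ _ h) (not-injective (∧-conicalʳ _ _ h)) W′-param
    on-Γ∧Γ[z] : ∀ w → Γ w ∧ adj G z w ≡ true → val2 G x w ≡ l
    on-Γ∧Γ[z] w h = adjCommon x w (∧-conicalˡ _ _ h)

  crossed-parameters : ∀ {y z b P P′} → Γ y ≡ true → Δ z ≡ true → adj G y z ≡ b →
    ParamFor G x y (if b then K12 else K2+K1) P → ParamFor G x z (if b then K12 else K2+K1) P′ →
    P ≡ P′
  crossed-parameters {y} {z} xy Δz yz P-param P′-param = begin
    _             ≡⟨ edge-param-at-Δ xy Δz yz P-param ⟨
    val3 G x y z  ≡⟨ val3-swap G x y z ⟩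
    val3 G x z y  ≡⟨ nonedge-param-at-Γ Δz xy (trans (Graph.sym G z y) yz) P′-param ⟩
    _             ∎
    where open ≡-Reasoning

  shared-parameter : ∀ {y z R W R′ W′} → Γ y ≡ true → Δ z ≡ true →
    ParamFor G x y K12 R → ParamFor G x y K2+K1 W → ParamFor G x z K12 R′ → ParamFor G x z K2+K1 W′ →
    R ≡ R′ ⊎ W ≡ W′
  shared-parameter {y} {z} xy Δz R-param W-param R′-param W′-param with adj G y z in yz
  ... | true  = inj₁ (crossed-parameters xy Δz yz R-param R′-param)
  ... | false = inj₂ (crossed-parameters xy Δz yz W-param W′-param)

proposition3p3 : (n k l m : ℕ) (G : Graph n) → IsSRG G k l m →
    (x : Fin n) → Locally3Isoregular G x →
    (y : Fin n) → Adj G x y → Isoregular3 G x y →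
    (Q R W : ℕ) → ParamFor G x y K3 Q → ParamFor G x y K12 R → ParamFor G x y K2+K1 W →
    (z : Fin n) → z ≢ x → ¬ Adj G x z → Isoregular3 G x z →
    (R' W' V : ℕ) → ParamFor G x z K12 R' → ParamFor G x z K2+K1 W' → ParamFor G x z 3K1 V →
    R ≡ R' × W ≡ W'
proposition3p3 n k l m G srg x _ y xy _ _ R W _ R-param W-param z z≢x x≁z _ R′ W′ _ R′-param W′-param _ =
  cancel-weighted-pair (m * A) (B * m) mA≢0 Bm≢0
    (eliminate-l {m = m} {A} {B} {C} (balance-Γ-Δ xy Δz)
      (edge-equation xy R-param W-param) (nonedge-equation Δz R′-param W′-param))
    (shared-parameter xy Δz R-param W-param R′-param W′-param)
  where
  open Subconstituents srg x
  Δz : Δ z ≡ true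
  Δz = Δ-intro (¬-not x≁z) (≢-sym z≢x)
  A B C : ℕ
  A = degreeIn G Δ y
  B = nonDegreeIn G Δ y
  C = nonDegreeIn G Γ z
  mA≢0 : NonZero (m * A)
  mA≢0 = m*n≢0 m A {{m-nonZero Δz}} {{degreeIn-Δ-nonZero xy Δz}}
  Bm≢0 : NonZero (B * m)
  Bm≢0 = m*n≢0 B m {{nonDegreeIn-Δ-nonZero xy Δz}} {{m-nonZero Δz}}
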